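{- Let $n\ge 0$. Let $\mathcal{D}_n$ be the set of lattice paths from $(0,0)$ to $(n,n)$ with steps $E=(1,0)$, $N=(0,1)$, $D=(1,1)$, and let $\mathcal{K}_{n+1,n}$ be the set of Kimberling paths from $(0,0)$ to $(n+1,n)$. For $P\in\mathcal{D}_n$ with $k$ East steps (hence also $k$ North steps), label each $E$ step and each $N$ step of $P$ with the $y$-coordinate of its terminal point; let $x_i$ be the label of the $i$-th $N$ step and $y_i$ the label of the $i$-th $E$ step ($1\le i\le k$), and let $\phi(P)$ be the path with vertex sequence $(0,0),(x_1,y_1),(x_2,y_2),\dots,(x_k,y_k),(n+1,n)$. Then $\phi(P)\in\mathcal{K}_{n+1,n}$ and has exactly $k$ interior vertices, and $\phi:\mathcal{D}_n\to\mathcal{K}_{n+1,n}$ is a bijection.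
   Context: A Kimberling path ending at $(i,j)$ is a lattice path starting at the origin $(0,0)$ and ending at $(i,j)$ each of whose steps joins two lattice points and has finite nonnegative slope (i.e., positive $x$-increment and nonnegative $y$-increment; vertical steps are not allowed, and steps may have any length). Equivalently, it is determined by its vertex sequence $(0,0)=v_0,v_1,\dots,v_{k+1}=(i,j)$ of lattice points with strictly increasing $x$-coordinates and weakly increasing $y$-coordinates; $v_1,\dots,v_k$ are its interior vertices (collinear consecutive steps are still counted as distinct steps, so e.g. the paths with vertex sequences $(0,0),(1,0),(2,0)$ and $(0,0),(2,0)$ are different). $\mathcal{K}_{i,j}$ denotes the set of such paths ending at $(i,j)$. -}

module Defs where

open import Data.Nat using (ℕ; zero; suc; _+_; _<_; _≤_)
open import Data.Product using (_×_; _,_; proj₁; proj₂)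
open import Data.List using (List; []; _∷_; _∷ʳ_; zip; length)
open import Data.List.Relation.Unary.Linked using (Linked)
open import Relation.Binary.PropositionalEquality using (_≡_)

data Step : Set where
  E N D : Step

Point : Set
Point = ℕ × ℕ

endpoint : List Step → Point
endpoint [] = (0 , 0)
endpoint (E ∷ s) = (suc (proj₁ (endpoint s)) , proj₂ (endpoint s))
endpoint (N ∷ s) = (proj₁ (endpoint s) , suc (proj₂ (endpoint s)))
endpoint (D ∷ s) = (suc (proj₁ (endpoint s)) , suc (proj₂ (endpoint s)))

IsDelannoy : ℕ → List Step → Set
IsDelannoy n P = endpoint P ≡ (n , n)

numE : List Step → ℕ
numE [] = 0
numE (E ∷ s) = suc (numE s)
numE (N ∷ s) = numE s
numE (D ∷ s) = numE s

labelsN : ℕ → List Step → List ℕ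
labelsN y [] = []
labelsN y (E ∷ s) = labelsN y s
labelsN y (N ∷ s) = suc y ∷ labelsN (suc y) s
labelsN y (D ∷ s) = labelsN (suc y) s

labelsE : ℕ → List Step → List ℕ
labelsE y [] = []
labelsE y (E ∷ s) = y ∷ labelsE y s
labelsE y (N ∷ s) = labelsE (suc y) s
labelsE y (D ∷ s) = labelsE (suc y) s

φ : List Step → List Point
φ P = zip (labelsN 0 P) (labelsE 0 P)

StepOK : Point → Point → Set
StepOK (a , b) (c , d) = (a < c) × (b ≤ d)

-- A Kimberling path ending at (i,j), represented by its list of interior
-- vertices vs: the full vertex sequence (0,0), vs, (i,j) must be StepOK-linked.
IsKimberling : ℕ → ℕ → List Point → Set
IsKimberling i j vs = Linked StepOK (((0 , 0) ∷ vs) ∷ʳ (i , j))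

module Submission where

-- The label of an E step is the height at which it is taken and that of an N step the
-- height it reaches, so along a Delannoy path to (n, n) the E-labels increase weakly
-- within [0, n] and the N-labels strictly within [1, n], and there are as many of each:
-- zipped, they are the interior vertices of a Kimberling path to (n + 1, n).  Conversely
-- the path is read back from the labels height by height: at height y take one E step
-- per E-label equal to y, then rise by N if y + 1 is an N-label and by D otherwise.

open import Defs
open import Data.Bool using (if_then_else_)
open import Data.List using (List; []; _∷_; _∷ʳ_; length; zip; unzip)
open import Data.List.Properties using (unzip-zip; zip-unzip; length-unzipWith₁; length-unzipWith₂)
open import Data.List.Relation.Unary.Linked using (Linked; [-]; _∷_)
open import Data.Nat using (ℕ; zero; suc; _+_; _<_; _≤_; _≮_; _≟_; s≤s; s≤s⁻¹)
open import Data.Nat.Properties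
  using (+-suc; +-identityʳ; +-cancelˡ-≡; +-cancelʳ-≡; m≤m+n; n<1+n; <⇒≤; ≤-refl; ≤-trans; <-trans; <-≤-trans; <-irrefl; ≤∧≢⇒<)
open import Data.Product using (_×_; Σ; _,_; proj₁; proj₂; map₁; map₂; uncurry)
import Data.Product as Product
open import Data.Product.Relation.Binary.Pointwise.NonDependent using (Pointwise)
open import Data.Unit using (⊤)
open import Function using (_∘_)
open import Relation.Binary.Core using (Rel)
open import Relation.Binary.Definitions using (Transitive)
open import Relation.Nullary using (does; yes; no; contradiction)
open import Relation.Nullary.Decidable using (dec-true; dec-false)
open import Relation.Binary.PropositionalEquality

module _ {a ℓ} {A : Set a} {R : Rel A ℓ} (trans : Transitive R) where

  Linked-lowerHead : ∀ {x y zs} → R x y → Linked R (y ∷ zs) → Linked R (x ∷ zs)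
  Linked-lowerHead Rxy [-]         = [-]
  Linked-lowerHead Rxy (Ryz ∷ Rzs) = trans Rxy Ryz ∷ Rzs

  Linked-head-last : ∀ {x z} ys → Linked R (x ∷ ys ∷ʳ z) → R x z
  Linked-head-last []       (Rxz ∷ [-]) = Rxz
  Linked-head-last (y ∷ ys) (Rxy ∷ Rys) = trans Rxy (Linked-head-last ys Rys)

module _ {a b r s} {A : Set a} {B : Set b} {R : Rel A r} {S : Rel B s} where

  Linked-unzip⁻ : ∀ {a b a′ b′} vs → Linked (Pointwise R S) ((a , b) ∷ vs ∷ʳ (a′ , b′)) →
                  Linked R (a ∷ proj₁ (unzip vs) ∷ʳ a′) × Linked S (b ∷ proj₂ (unzip vs) ∷ʳ b′)
  Linked-unzip⁻ []       ((r , s) ∷ [-])  = r ∷ [-] , s ∷ [-]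
  Linked-unzip⁻ (v ∷ vs) ((r , s) ∷ Rvs) = Product.map (r ∷_) (s ∷_) (Linked-unzip⁻ vs Rvs)

  Linked-unzip⁺ : ∀ {a b a′ b′} vs →
                  Linked R (a ∷ proj₁ (unzip vs) ∷ʳ a′) → Linked S (b ∷ proj₂ (unzip vs) ∷ʳ b′) →
                  Linked (Pointwise R S) ((a , b) ∷ vs ∷ʳ (a′ , b′))
  Linked-unzip⁺ []       (r ∷ [-]) (s ∷ [-]) = (r , s) ∷ [-]
  Linked-unzip⁺ (v ∷ vs) (r ∷ Rs)  (s ∷ Ss)  = (r , s) ∷ Linked-unzip⁺ vs Rs Ss

KimberlingCoordinates : ℕ → ℕ → List ℕ × List ℕ → Set
KimberlingCoordinates i j (xs , ys) = Linked _<_ (0 ∷ xs ∷ʳ i) × Linked _≤_ (0 ∷ ys ∷ʳ j)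

IsKimberling⇒coordinates : ∀ {i j} vs → IsKimberling i j vs → KimberlingCoordinates i j (unzip vs)
IsKimberling⇒coordinates = Linked-unzip⁻

coordinates⇒IsKimberling : ∀ {i j} vs → KimberlingCoordinates i j (unzip vs) → IsKimberling i j vs
coordinates⇒IsKimberling vs = uncurry (Linked-unzip⁺ vs)

width height : List Step → ℕ
width P  = proj₁ (endpoint P)
height P = proj₂ (endpoint P)

labels : ℕ → List Step → List ℕ × List ℕ
labels y P = labelsN y P , labelsE y P

labelsN-linked : ∀ P y → Linked _<_ (y ∷ labelsN y P ∷ʳ suc (y + height P))
labelsN-linked []      y = s≤s (m≤m+n y 0) ∷ [-]
labelsN-linked (E ∷ P) y = labelsN-linked P y
labelsN-linked (N ∷ P) y rewrite +-suc y (height P) = n<1+n y ∷ labelsN-linked P (suc y)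
labelsN-linked (D ∷ P) y rewrite +-suc y (height P) =
  Linked-lowerHead <-trans (n<1+n y) (labelsN-linked P (suc y))

labelsE-linked : ∀ P y → Linked _≤_ (y ∷ labelsE y P ∷ʳ (y + height P))
labelsE-linked []      y = m≤m+n y 0 ∷ [-]
labelsE-linked (E ∷ P) y = ≤-refl ∷ labelsE-linked P y
labelsE-linked (N ∷ P) y rewrite +-suc y (height P) =
  Linked-lowerHead ≤-trans (<⇒≤ (n<1+n y)) (labelsE-linked P (suc y))
labelsE-linked (D ∷ P) y rewrite +-suc y (height P) =
  Linked-lowerHead ≤-trans (<⇒≤ (n<1+n y)) (labelsE-linked P (suc y))

length-labelsE : ∀ P y → length (labelsE y P) ≡ numE P
length-labelsE []      y = refl
length-labelsE (E ∷ P) y = cong suc (length-labelsE P y)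
length-labelsE (N ∷ P) y = length-labelsE P (suc y)
length-labelsE (D ∷ P) y = length-labelsE P (suc y)

width+∣labelsN∣≡height+∣labelsE∣ : ∀ P y → width P + length (labelsN y P) ≡ height P + length (labelsE y P)
width+∣labelsN∣≡height+∣labelsE∣ []      y = refl
width+∣labelsN∣≡height+∣labelsE∣ (E ∷ P) y =
  trans (cong suc (width+∣labelsN∣≡height+∣labelsE∣ P y)) (sym (+-suc (height P) _))
width+∣labelsN∣≡height+∣labelsE∣ (N ∷ P) y =
  trans (+-suc (width P) _) (cong suc (width+∣labelsN∣≡height+∣labelsE∣ P (suc y)))
width+∣labelsN∣≡height+∣labelsE∣ (D ∷ P) y = cong suc (width+∣labelsN∣≡height+∣labelsE∣ P (suc y))

-- decode d y xs ys: the path from height y that climbs d more and has N-labels xs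
-- and E-labels ys; rise d y xs ys is the same after the E steps at height y.
mutual
  decode : ℕ → ℕ → List ℕ → List ℕ → List Step
  decode d y xs []       = rise d y xs []
  decode d y xs (z ∷ ys) = if does (z ≟ y) then E ∷ decode d y xs ys else rise d y xs (z ∷ ys)

  rise : ℕ → ℕ → List ℕ → List ℕ → List Step
  rise zero    y xs       ys = []
  rise (suc d) y []       ys = D ∷ decode d (suc y) [] ys
  rise (suc d) y (x ∷ xs) ys = if does (x ≟ suc y) then N ∷ decode d (suc y) xs ys else D ∷ decode d (suc y) (x ∷ xs) ys

infix 4 _<ₕ_
_<ₕ_ : ℕ → List ℕ → Set
y <ₕ []    = ⊤
y <ₕ z ∷ _ = y < z

decode-E : ∀ d y xs ys → decode d y xs (y ∷ ys) ≡ E ∷ decode d y xs ys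
decode-E d y xs ys rewrite dec-true (y ≟ y) refl = refl

decode-rise : ∀ d y xs ys → y <ₕ ys → decode d y xs ys ≡ rise d y xs ys
decode-rise d y xs []       _   = refl
decode-rise d y xs (z ∷ ys) y<z rewrite dec-false (z ≟ y) (λ z≡y → <-irrefl (sym z≡y) y<z) = refl

rise-N : ∀ d y xs ys → rise (suc d) y (suc y ∷ xs) ys ≡ N ∷ decode d (suc y) xs ys
rise-N d y xs ys rewrite dec-true (suc y ≟ suc y) refl = refl

rise-D : ∀ d y xs ys → suc y <ₕ xs → rise (suc d) y xs ys ≡ D ∷ decode d (suc y) xs ys
rise-D d y []       ys _    = refl
rise-D d y (x ∷ xs) ys sy<x rewrite dec-false (x ≟ suc y) (λ x≡sy → <-irrefl (sym x≡sy) sy<x) = refl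

<ₕ-from-< : ∀ {y m} zs → Linked _<_ (y ∷ zs ∷ʳ m) → y <ₕ zs
<ₕ-from-< []       _         = _
<ₕ-from-< (z ∷ zs) (y<z ∷ _) = y<z

<ₕ-from-≤ : ∀ {y m} zs → Linked _≤_ (suc y ∷ zs ∷ʳ m) → y <ₕ zs
<ₕ-from-≤ []       _         = _
<ₕ-from-≤ (z ∷ zs) (y<z ∷ _) = y<z

decode-labels : ∀ P y → decode (height P) y (labelsN y P) (labelsE y P) ≡ P
decode-labels []      y = refl
decode-labels (E ∷ P) y = trans (decode-E (height P) y (labelsN y P) (labelsE y P)) (cong (E ∷_) (decode-labels P y))
decode-labels (N ∷ P) y = begin
  decode (suc (height P)) y (suc y ∷ labelsN (suc y) P) (labelsE (suc y) P)
    ≡⟨ decode-rise _ y _ _ (<ₕ-from-≤ _ (labelsE-linked P (suc y))) ⟩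
  rise (suc (height P)) y (suc y ∷ labelsN (suc y) P) (labelsE (suc y) P)
    ≡⟨ rise-N (height P) y (labelsN (suc y) P) (labelsE (suc y) P) ⟩
  N ∷ decode (height P) (suc y) (labelsN (suc y) P) (labelsE (suc y) P)
    ≡⟨ cong (N ∷_) (decode-labels P (suc y)) ⟩
  N ∷ P ∎
  where open ≡-Reasoning
decode-labels (D ∷ P) y = begin
  decode (suc (height P)) y (labelsN (suc y) P) (labelsE (suc y) P)
    ≡⟨ decode-rise _ y _ _ (<ₕ-from-≤ _ (labelsE-linked P (suc y))) ⟩
  rise (suc (height P)) y (labelsN (suc y) P) (labelsE (suc y) P)
    ≡⟨ rise-D _ y _ _ (<ₕ-from-< _ (labelsN-linked P (suc y))) ⟩
  D ∷ decode (height P) (suc y) (labelsN (suc y) P) (labelsE (suc y) P)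
    ≡⟨ cong (D ∷_) (decode-labels P (suc y)) ⟩
  D ∷ P ∎
  where open ≡-Reasoning

record HasLabels (d y : ℕ) (xs ys : List ℕ) (P : List Step) : Set where
  constructor hasLabels
  field
    height≡ : height P ≡ d
    labels≡ : labels y P ≡ (xs , ys)

HasLabels-E : ∀ {d y xs ys P} → HasLabels d y xs ys P → HasLabels d y xs (y ∷ ys) (E ∷ P)
HasLabels-E {y = y} (hasLabels h l) = hasLabels h (cong (map₂ (y ∷_)) l)

HasLabels-N : ∀ {d y xs ys P} → HasLabels d (suc y) xs ys P → HasLabels (suc d) y (suc y ∷ xs) ys (N ∷ P)
HasLabels-N {y = y} (hasLabels h l) = hasLabels (cong suc h) (cong (map₁ (suc y ∷_)) l)

HasLabels-D : ∀ {d y xs ys P} → HasLabels d (suc y) xs ys P → HasLabels (suc d) y xs ys (D ∷ P)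
HasLabels-D (hasLabels h l) = hasLabels (cong suc h) l

n+0≡m⇒n≮m : ∀ {n m} → n + 0 ≡ m → n ≮ m
n+0≡m⇒n≮m {n} n+0≡m = <-irrefl (trans (sym (+-identityʳ n)) n+0≡m)

raise-≤-chain : ∀ {y m} ys → suc y ≤ m → Linked _≤_ (y ∷ ys ∷ʳ m) → y <ₕ ys → Linked _≤_ (suc y ∷ ys ∷ʳ m)
raise-≤-chain []      sy≤m _         _   = sy≤m ∷ [-]
raise-≤-chain (_ ∷ _) _    (_ ∷ Lys) y<z = y<z ∷ Lys

mutual
  decode-hasLabels : ∀ d y m xs ys → y + d ≡ m → Linked _<_ (y ∷ xs ∷ʳ suc m) → Linked _≤_ (y ∷ ys ∷ʳ m) →
                     HasLabels d y xs ys (decode d y xs ys)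
  decode-hasLabels d y m xs [] eq Lxs Lys = rise-hasLabels d y m xs [] eq Lxs Lys _
  decode-hasLabels d y m xs (z ∷ ys) eq Lxs (y≤z ∷ Lys) with z ≟ y
  ... | yes refl rewrite decode-E d y xs ys = HasLabels-E (decode-hasLabels d y m xs ys eq Lxs Lys)
  ... | no z≢y   = subst (HasLabels d y xs (z ∷ ys)) (sym (decode-rise d y xs (z ∷ ys) y<z))
                     (rise-hasLabels d y m xs (z ∷ ys) eq Lxs (y≤z ∷ Lys) y<z)
    where y<z = ≤∧≢⇒< y≤z (z≢y ∘ sym)

  rise-hasLabels : ∀ d y m xs ys → y + d ≡ m → Linked _<_ (y ∷ xs ∷ʳ suc m) → Linked _≤_ (y ∷ ys ∷ʳ m) → y <ₕ ys →
                   HasLabels d y xs ys (rise d y xs ys)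
  rise-hasLabels zero y m []       []       eq _           _         _   = hasLabels refl refl
  rise-hasLabels zero y m []       (z ∷ ys) eq _           (_ ∷ Lzs) y<z =
    contradiction (<-≤-trans y<z (Linked-head-last ≤-trans ys Lzs)) (n+0≡m⇒n≮m eq)
  rise-hasLabels zero y m (x ∷ xs) ys       eq (y<x ∷ Lxs) _         _   =
    contradiction (<-≤-trans y<x (s≤s⁻¹ (Linked-head-last <-trans xs Lxs))) (n+0≡m⇒n≮m eq)
  rise-hasLabels (suc d) y m xs ys eq Lxs Lys y<ys = climb xs Lxs
    where
    eq′ : suc y + d ≡ m
    eq′ = trans (sym (+-suc y d)) eq
    sy≤m : suc y ≤ m
    sy≤m = subst (suc y ≤_) eq′ (m≤m+n (suc y) d)
    Lys′ : Linked _≤_ (suc y ∷ ys ∷ʳ m)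
    Lys′ = raise-≤-chain ys sy≤m Lys y<ys
    climb : ∀ xs → Linked _<_ (y ∷ xs ∷ʳ suc m) → HasLabels (suc d) y xs ys (rise (suc d) y xs ys)
    climb []       _           = HasLabels-D (decode-hasLabels d (suc y) m [] ys eq′ (s≤s sy≤m ∷ [-]) Lys′)
    climb (x ∷ xs) (y<x ∷ Lxs) with x ≟ suc y
    ... | yes refl rewrite rise-N d y xs ys = HasLabels-N (decode-hasLabels d (suc y) m xs ys eq′ Lxs Lys′)
    ... | no x≢sy  = subst (HasLabels (suc d) y (x ∷ xs) ys) (sym (rise-D d y (x ∷ xs) ys sy<x))
                       (HasLabels-D (decode-hasLabels d (suc y) m (x ∷ xs) ys eq′ (sy<x ∷ Lxs) Lys′))
      where sy<x = ≤∧≢⇒< y<x (x≢sy ∘ sym)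

IsDelannoy⇒height≡ : ∀ {n} P → IsDelannoy n P → height P ≡ n
IsDelannoy⇒height≡ P = cong proj₂

IsDelannoy⇒∣labelsN∣≡∣labelsE∣ : ∀ {n} P → IsDelannoy n P → length (labelsN 0 P) ≡ length (labelsE 0 P)
IsDelannoy⇒∣labelsN∣≡∣labelsE∣ {n} P P∈𝒟 = +-cancelˡ-≡ n _ _ (begin
  n + length (labelsN 0 P)        ≡⟨ cong (λ e → proj₁ e + _) P∈𝒟 ⟨
  width P + length (labelsN 0 P)  ≡⟨ width+∣labelsN∣≡height+∣labelsE∣ P 0 ⟩
  height P + length (labelsE 0 P) ≡⟨ cong (λ e → proj₂ e + _) P∈𝒟 ⟩
  n + length (labelsE 0 P)        ∎)
  where open ≡-Reasoning

unzip-φ : ∀ {n} P → IsDelannoy n P → unzip (φ P) ≡ labels 0 P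
unzip-φ P P∈𝒟 = unzip-zip (labelsN 0 P) (labelsE 0 P) (IsDelannoy⇒∣labelsN∣≡∣labelsE∣ P P∈𝒟)

φ-isKimberling : ∀ {n} P → IsDelannoy n P → IsKimberling (suc n) n (φ P)
φ-isKimberling {n} P P∈𝒟 = coordinates⇒IsKimberling (φ P)
  (subst (KimberlingCoordinates (suc n) n) (sym (unzip-φ P P∈𝒟))
    (subst (λ h → KimberlingCoordinates (suc h) h (labels 0 P)) (IsDelannoy⇒height≡ P P∈𝒟)
      (labelsN-linked P 0 , labelsE-linked P 0)))

length-φ : ∀ {n} P → IsDelannoy n P → length (φ P) ≡ numE P
length-φ P P∈𝒟 = begin
  length (φ P)                  ≡⟨ length-unzipWith₂ _ (φ P) ⟨
  length (proj₂ (unzip (φ P)))  ≡⟨ cong (length ∘ proj₂) (unzip-φ P P∈𝒟) ⟩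
  length (labelsE 0 P)          ≡⟨ length-labelsE P 0 ⟩
  numE P                        ∎
  where open ≡-Reasoning

decode-φ : ∀ {n} P → IsDelannoy n P → uncurry (decode n 0) (unzip (φ P)) ≡ P
decode-φ {n} P P∈𝒟 = begin
  uncurry (decode n 0) (unzip (φ P))           ≡⟨ cong (uncurry (decode n 0)) (unzip-φ P P∈𝒟) ⟩
  uncurry (decode n 0) (labels 0 P)            ≡⟨ cong (λ h → uncurry (decode h 0) (labels 0 P)) (IsDelannoy⇒height≡ P P∈𝒟) ⟨
  uncurry (decode (height P) 0) (labels 0 P)   ≡⟨ decode-labels P 0 ⟩
  P                                            ∎
  where open ≡-Reasoning

φ-injective : ∀ {n} P Q → IsDelannoy n P → IsDelannoy n Q → φ P ≡ φ Q → P ≡ Q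
φ-injective {n} P Q P∈𝒟 Q∈𝒟 φP≡φQ = begin
  P                                   ≡⟨ decode-φ P P∈𝒟 ⟨
  uncurry (decode n 0) (unzip (φ P))  ≡⟨ cong (uncurry (decode n 0) ∘ unzip) φP≡φQ ⟩
  uncurry (decode n 0) (unzip (φ Q))  ≡⟨ decode-φ Q Q∈𝒟 ⟩
  Q                                   ∎
  where open ≡-Reasoning

φ-surjective : ∀ {n} vs → IsKimberling (suc n) n vs → Σ (List Step) (λ P → IsDelannoy n P × φ P ≡ vs)
φ-surjective {n} vs K = P , cong₂ _,_ width≡n height≡n , φP≡vs
  where
  xs = proj₁ (unzip vs)
  ys = proj₂ (unzip vs)
  P = decode n 0 xs ys
  Lxs,Lys = IsKimberling⇒coordinates vs K
  open HasLabels (decode-hasLabels n 0 n xs ys refl (proj₁ Lxs,Lys) (proj₂ Lxs,Lys)) renaming (height≡ to height≡n)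
  φP≡vs : φ P ≡ vs
  φP≡vs = trans (cong (uncurry zip) labels≡) (zip-unzip vs)
  width≡n : width P ≡ n
  width≡n = +-cancelʳ-≡ _ _ _ (begin
    width P + length (labelsN 0 P)  ≡⟨ width+∣labelsN∣≡height+∣labelsE∣ P 0 ⟩
    height P + length (labelsE 0 P) ≡⟨ cong₂ _+_ height≡n (cong (length ∘ proj₂) labels≡) ⟩
    n + length ys                   ≡⟨ cong (n +_) (trans (length-unzipWith₂ _ vs) (sym (length-unzipWith₁ _ vs))) ⟩
    n + length xs                   ≡⟨ cong (λ l → n + length (proj₁ l)) labels≡ ⟨
    n + length (labelsN 0 P)        ∎)
    where open ≡-Reasoning

mainTheorem1 : (n : ℕ) →
    ((P : List Step) → IsDelannoy n P →
        IsKimberling (suc n) n (φ P) × length (φ P) ≡ numE P)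
    × ((P Q : List Step) → IsDelannoy n P → IsDelannoy n Q → φ P ≡ φ Q → P ≡ Q)
    × ((vs : List Point) → IsKimberling (suc n) n vs →
        Σ (List Step) (λ P → IsDelannoy n P × φ P ≡ vs))
mainTheorem1 n = (λ P P∈𝒟 → φ-isKimberling P P∈𝒟 , length-φ P P∈𝒟) , φ-injective , φ-surjective
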